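{- For every $\alpha\in\mathbb{C}$ and every $n\in\mathbb{N}$, $$ {}_{\mathcal{B}}\mathcal{E}_{n+1}^{(\alpha)}(x+1;y)-{}_{\mathcal{B}}\mathcal{E}_{n+1}^{(\alpha)}(x;y)=\sum_{k=0}^{n}\binom{n+1}{k}\,{}_{\mathcal{B}}\mathcal{E}_k^{(\alpha)}(x;y).$$
   Context: For $\alpha\in\mathbb{C}$, the Bell based Euler polynomials of order $\alpha$ are defined by $\sum_{n\ge0}{}_{\mathcal{B}}\mathcal{E}_n^{(\alpha)}(x;y)\frac{t^n}{n!}=\left(\frac{2}{e^t+1}\right)^{\alpha}e^{xt+y(e^t-1)}$. -}

module Defs where

open import Algebra.Bundles using (CommutativeRing)
open import Data.Nat using (ℕ; zero; suc; _∸_)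
open import Data.Nat.Combinatorics using (_C_)

-- Bell based Euler polynomials of order α, defined through their generating
-- function, with coefficients (α, x, y) in a commutative ring R that is a
-- ℚ-algebra.  `inv n` is meant to be the inverse of (suc n) in R (the
-- hypothesis saying so is part of the theorem statement).
module BellEuler {c ℓ} (R : CommutativeRing c ℓ) (inv : ℕ → CommutativeRing.Carrier R) where

  open CommutativeRing R

  infixr 8 _^_

  fromℕ : ℕ → Carrier
  fromℕ zero    = 0#
  fromℕ (suc n) = 1# + fromℕ n

  sumTo : ℕ → (ℕ → Carrier) → Carrier
  sumTo zero    f = 0#
  sumTo (suc n) f = sumTo n f + f n

  prodTo : ℕ → (ℕ → Carrier) → Carrier
  prodTo zero    f = 1#
  prodTo (suc n) f = prodTo n f * f n

  _^_ : Carrier → ℕ → Carrier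
  a ^ zero  = 1#
  a ^ suc n = a * (a ^ n)

  -- 1 / n!
  invFact : ℕ → Carrier
  invFact n = prodTo n inv

  -- formal power series in t over R, given by their coefficient sequences
  PS : Set c
  PS = ℕ → Carrier

  oneS : PS
  oneS zero    = 1#
  oneS (suc n) = 0#

  _⊛_ : PS → PS → PS
  (f ⊛ g) n = sumTo (suc n) (λ k → f k * g (n ∸ k))

  powS : PS → ℕ → PS
  powS u zero    = oneS
  powS u (suc j) = u ⊛ powS u j

  -- substitution of a series u with zero constant term into Σ_j a_j z^j
  substS : (ℕ → Carrier) → PS → PS
  substS a u n = sumTo (suc n) (λ j → a j * powS u j n)

  expS : Carrier → PS
  expS a n = (a ^ n) * invFact n

  expm1 : PS
  expm1 zero    = 0#
  expm1 (suc n) = invFact (suc n)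

  -- (e^t - 1)/2 = (e^t + 1)/2 - 1
  halfExpm1 : PS
  halfExpm1 n = inv 1 * expm1 n

  gbinom : Carrier → ℕ → Carrier
  gbinom β j = prodTo j (λ i → β - fromℕ i) * invFact j

  -- (2/(e^t+1))^α = (1 + (e^t-1)/2)^(-α) = Σ_j binom(-α, j) ((e^t-1)/2)^j
  eulerFactor : Carrier → PS
  eulerFactor α = substS (gbinom (- α)) halfExpm1

  -- e^{y(e^t - 1)} = Σ_j y^j/j! (e^t - 1)^j
  bellFactor : Carrier → PS
  bellFactor y = substS (λ j → (y ^ j) * invFact j) expm1

  genFun : Carrier → Carrier → Carrier → PS
  genFun α x y = eulerFactor α ⊛ (expS x ⊛ bellFactor y)

  factR : ℕ → Carrier
  factR n = prodTo n (λ i → fromℕ (suc i))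

  BE : ℕ → Carrier → Carrier → Carrier → Carrier
  BE n α x y = factR n * genFun α x y n

  binomR : ℕ → ℕ → Carrier
  binomR n k = fromℕ (n C k)

{-# OPTIONS --safe #-}
module Submission where

-- Replacing x by x + z multiplies the generating function by e^{zt}, because
-- e^{(x+z)t} = e^{xt} e^{zt} (binomial theorem).  Comparing coefficients of t^n gives
-- the addition formula  BE_n(x + z) = Σ_k C(n,k) BE_k(x) z^{n-k};  for z = 1 and
-- degree n + 1 the top summand is BE_{n+1}(x) itself, and the rest is the right-hand side.

open import Defs
open import Algebra.Bundles using (CommutativeRing)
open import Data.Fin.Base using (Fin; toℕ)
open import Data.Nat.Base as ℕ using (ℕ; zero; suc; _≤_; _<_; _∸_; s≤s; _!)
import Data.Nat.Properties as ℕ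
open import Data.Nat.Combinatorics using (_C_; nCk≡n!/k![n-k]!; nCn≡1; k![n∸k]!∣n!)
open import Data.Nat.DivMod using (m/n*n≡m)
open import Function.Base using (_∘_)
open import Relation.Binary.PropositionalEquality as ≡ using (_≡_)
import Algebra.Properties.CommutativeSemigroup as CommutativeSemigroupProperties
import Algebra.Properties.CommutativeSemiring.Binomial as Binomial
import Algebra.Properties.Group as GroupProperties
import Algebra.Properties.Monoid.Sum as MonoidSum
import Algebra.Properties.Semiring.Exp as SemiringExp
import Algebra.Properties.Semiring.Mult as SemiringMult

nCk*[k!*[n∸k]!]≡n! : ∀ {n k} → k ≤ n → (n C k) ℕ.* (k ! ℕ.* (n ∸ k) !) ≡ n !
nCk*[k!*[n∸k]!]≡n! {n} {k} k≤n =
  ≡.trans (≡.cong (ℕ._* (k ! ℕ.* (n ∸ k) !)) (nCk≡n!/k![n-k]! k≤n))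
          (m/n*n≡m {{ℕ._!*_!≢0 k (n ∸ k)}} (k![n∸k]!∣n! k≤n))

module BellEulerProperties {c ℓ} (R : CommutativeRing c ℓ) (inv : ℕ → CommutativeRing.Carrier R) where

  open CommutativeRing R
  open BellEuler R inv
  open CommutativeSemigroupProperties +-commutativeSemigroup
    using () renaming (interchange to +-interchange)
  open CommutativeSemigroupProperties *-commutativeSemigroup
    using () renaming (interchange to *-interchange; x∙yz≈y∙xz to *-leftComm)
  open MonoidSum +-monoid using (sum)
  open SemiringMult semiring using (_×_; ×-congʳ; ×-assoc-*; ×1-homo-*)
  open SemiringExp semiring using () renaming (_^_ to _^′_)
  open import Relation.Binary.Reasoning.Setoid setoid

  sumTo-cong : ∀ n {f g} → (∀ {k} → k < n → f k ≈ g k) → sumTo n f ≈ sumTo n g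
  sumTo-cong zero    f≈g = refl
  sumTo-cong (suc n) f≈g = +-cong (sumTo-cong n (f≈g ∘ ℕ.m<n⇒m<1+n)) (f≈g (ℕ.n<1+n n))

  sumTo-distrib-+ : ∀ n f g → sumTo n (λ k → f k + g k) ≈ sumTo n f + sumTo n g
  sumTo-distrib-+ zero    f g = sym (+-identityʳ 0#)
  sumTo-distrib-+ (suc n) f g =
    trans (+-congʳ (sumTo-distrib-+ n f g)) (+-interchange _ _ _ _)

  *-distribʳ-sumTo : ∀ a n f → sumTo n f * a ≈ sumTo n (λ k → f k * a)
  *-distribʳ-sumTo a zero    f = zeroˡ a
  *-distribʳ-sumTo a (suc n) f = trans (distribʳ a _ _) (+-congʳ (*-distribʳ-sumTo a n f))

  *-distribˡ-sumTo : ∀ a n f → a * sumTo n f ≈ sumTo n (λ k → a * f k)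
  *-distribˡ-sumTo a n f = begin
    a * sumTo n f              ≈⟨ *-comm a _ ⟩
    sumTo n f * a              ≈⟨ *-distribʳ-sumTo a n f ⟩
    sumTo n (λ k → f k * a)    ≈⟨ sumTo-cong n (λ _ → *-comm _ a) ⟩
    sumTo n (λ k → a * f k)    ∎

  sumTo-unfoldˡ : ∀ n f → sumTo (suc n) f ≈ f 0 + sumTo n (f ∘ suc)
  sumTo-unfoldˡ zero    f = trans (+-identityˡ _) (sym (+-identityʳ _))
  sumTo-unfoldˡ (suc n) f = trans (+-congʳ (sumTo-unfoldˡ n f)) (+-assoc _ _ _)

  sumTo-reverse : ∀ n f → sumTo n f ≈ sumTo n (λ k → f (n ∸ suc k))
  sumTo-reverse zero    f = refl
  sumTo-reverse (suc n) f = begin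
    sumTo n f + f n                        ≈⟨ +-comm _ _ ⟩
    f n + sumTo n f                        ≈⟨ +-congˡ (sumTo-reverse n f) ⟩
    f n + sumTo n (λ k → f (n ∸ suc k))    ≈⟨ sumTo-unfoldˡ n (λ k → f (n ∸ k)) ⟨
    sumTo (suc n) (λ k → f (n ∸ k))        ∎

  sumTo-exchange : ∀ n (F : ℕ → ℕ → Carrier) →
                   sumTo n (λ k → sumTo (suc k) (λ i → F i k))
                   ≈ sumTo n (λ i → sumTo (n ∸ i) (λ j → F i (i ℕ.+ j)))
  sumTo-exchange zero    F = refl
  sumTo-exchange (suc n) F = begin
    sumTo n (λ k → sumTo (suc k) (λ i → F i k)) + sumTo (suc n) (λ i → F i n)
      ≈⟨ +-congʳ (sumTo-exchange n F) ⟩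
    sumTo n row + sumTo (suc n) (λ i → F i n)
      ≈⟨ +-congʳ (trans (+-congˡ lastRow-empty) (+-identityʳ _)) ⟨
    sumTo (suc n) row + sumTo (suc n) (λ i → F i n)
      ≈⟨ sumTo-distrib-+ (suc n) row (λ i → F i n) ⟨
    sumTo (suc n) (λ i → row i + F i n)
      ≈⟨ sumTo-cong (suc n) extendRow ⟩
    sumTo (suc n) (λ i → sumTo (suc n ∸ i) (λ j → F i (i ℕ.+ j)))  ∎
    where
    row : ℕ → Carrier
    row i = sumTo (n ∸ i) (λ j → F i (i ℕ.+ j))

    lastRow-empty : row n ≈ 0#
    lastRow-empty = reflexive (≡.cong (λ m → sumTo m (λ j → F n (n ℕ.+ j))) (ℕ.n∸n≡0 n))

    extendRow : ∀ {i} → i < suc n → row i + F i n ≈ sumTo (suc n ∸ i) (λ j → F i (i ℕ.+ j))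
    extendRow {i} (s≤s i≤n) = begin
      row i + F i n                                  ≈⟨ +-congˡ (reflexive (≡.cong (F i) (ℕ.m+[n∸m]≡n i≤n))) ⟨
      sumTo (suc (n ∸ i)) (λ j → F i (i ℕ.+ j))      ≡⟨ ≡.cong (λ m → sumTo m (λ j → F i (i ℕ.+ j))) (ℕ.+-∸-assoc 1 i≤n) ⟨
      sumTo (suc n ∸ i) (λ j → F i (i ℕ.+ j))        ∎

  sumTo≈sum : ∀ n f → sumTo n f ≈ sum (λ (i : Fin n) → f (toℕ i))
  sumTo≈sum zero    f = refl
  sumTo≈sum (suc n) f = trans (sumTo-unfoldˡ n f) (+-congˡ (sumTo≈sum n (f ∘ suc)))

  ^≈^′ : ∀ a n → a ^ n ≈ a ^′ n
  ^≈^′ a zero    = refl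
  ^≈^′ a (suc n) = *-congˡ (^≈^′ a n)

  1#^n≈1# : ∀ n → 1# ^ n ≈ 1#
  1#^n≈1# zero    = refl
  1#^n≈1# (suc n) = trans (*-identityˡ _) (1#^n≈1# n)

  fromℕ≈×1# : ∀ n → fromℕ n ≈ n × 1#
  fromℕ≈×1# zero    = refl
  fromℕ≈×1# (suc n) = +-congˡ (fromℕ≈×1# n)

  fromℕ-1 : fromℕ 1 ≈ 1#
  fromℕ-1 = +-identityʳ 1#

  fromℕ-* : ∀ m n → fromℕ (m ℕ.* n) ≈ fromℕ m * fromℕ n
  fromℕ-* m n = begin
    fromℕ (m ℕ.* n)            ≈⟨ fromℕ≈×1# (m ℕ.* n) ⟩
    (m ℕ.* n) × 1#             ≈⟨ ×1-homo-* m n ⟩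
    (m × 1#) * (n × 1#)        ≈⟨ *-cong (fromℕ≈×1# m) (fromℕ≈×1# n) ⟨
    fromℕ m * fromℕ n          ∎

  ×≈fromℕ* : ∀ n a → n × a ≈ fromℕ n * a
  ×≈fromℕ* n a = begin
    n × a              ≈⟨ ×-congʳ n (*-identityˡ a) ⟨
    n × (1# * a)       ≈⟨ ×-assoc-* n 1# a ⟨
    (n × 1#) * a       ≈⟨ *-congʳ (fromℕ≈×1# n) ⟨
    fromℕ n * a        ∎

  binomial-theorem : ∀ a b n → (a + b) ^ n ≈ sumTo (suc n) (λ k → binomR n k * (a ^ k * b ^ (n ∸ k)))
  binomial-theorem a b n = begin
    (a + b) ^ n                    ≈⟨ ^≈^′ (a + b) n ⟩
    (a + b) ^′ n                   ≈⟨ Binomial.theorem commutativeSemiring n a b ⟩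
    Binomial.binomialExpansion commutativeSemiring a b n
      ≈⟨ sumTo≈sum (suc n) (λ k → (n C k) × (a ^′ k * b ^′ (n ∸ k))) ⟨
    sumTo (suc n) (λ k → (n C k) × (a ^′ k * b ^′ (n ∸ k)))
      ≈⟨ sumTo-cong (suc n) (λ {k} _ → trans (×≈fromℕ* (n C k) _)
           (*-congˡ (sym (*-cong (^≈^′ a k) (^≈^′ b (n ∸ k)))))) ⟩
    sumTo (suc n) (λ k → binomR n k * (a ^ k * b ^ (n ∸ k)))  ∎

  infix 4 _≈ₛ_
  _≈ₛ_ : PS → PS → Set ℓ
  f ≈ₛ g = ∀ n → f n ≈ g n

  ⊛-congˡ : ∀ f {g g′} → g ≈ₛ g′ → f ⊛ g ≈ₛ f ⊛ g′
  ⊛-congˡ f g≈g′ n = sumTo-cong (suc n) (λ {k} _ → *-congˡ (g≈g′ (n ∸ k)))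

  ⊛-congʳ : ∀ {f f′} g → f ≈ₛ f′ → f ⊛ g ≈ₛ f′ ⊛ g
  ⊛-congʳ g f≈f′ n = sumTo-cong (suc n) (λ {k} _ → *-congʳ (f≈f′ k))

  ⊛-comm : ∀ f g → f ⊛ g ≈ₛ g ⊛ f
  ⊛-comm f g n = trans (sumTo-reverse (suc n) (λ k → f k * g (n ∸ k)))
    (sumTo-cong (suc n) (λ {k} k<1+n →
      trans (*-congˡ (reflexive (≡.cong g (ℕ.m∸[m∸n]≡n (ℕ.≤-pred k<1+n))))) (*-comm _ _)))

  ⊛-assoc : ∀ f g h → (f ⊛ g) ⊛ h ≈ₛ f ⊛ (g ⊛ h)
  ⊛-assoc f g h n = begin
    sumTo (suc n) (λ k → sumTo (suc k) (λ i → f i * g (k ∸ i)) * h (n ∸ k))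
      ≈⟨ sumTo-cong (suc n) (λ {k} _ → *-distribʳ-sumTo (h (n ∸ k)) (suc k) _) ⟩
    sumTo (suc n) (λ k → sumTo (suc k) (λ i → F i k))
      ≈⟨ sumTo-exchange (suc n) F ⟩
    sumTo (suc n) (λ i → sumTo (suc n ∸ i) (λ j → F i (i ℕ.+ j)))
      ≈⟨ sumTo-cong (suc n) reindex ⟩
    sumTo (suc n) (λ i → sumTo (suc (n ∸ i)) (λ j → f i * (g j * h (n ∸ i ∸ j))))
      ≈⟨ sumTo-cong (suc n) (λ {i} _ → *-distribˡ-sumTo (f i) (suc (n ∸ i)) _) ⟨
    sumTo (suc n) (λ i → f i * (g ⊛ h) (n ∸ i))  ∎
    where
    F : ℕ → ℕ → Carrier
    F i k = f i * g (k ∸ i) * h (n ∸ k)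

    reindex : ∀ {i} → i < suc n →
              sumTo (suc n ∸ i) (λ j → F i (i ℕ.+ j))
              ≈ sumTo (suc (n ∸ i)) (λ j → f i * (g j * h (n ∸ i ∸ j)))
    reindex {i} (s≤s i≤n) = begin
      sumTo (suc n ∸ i) (λ j → F i (i ℕ.+ j))
        ≡⟨ ≡.cong (λ m → sumTo m (λ j → F i (i ℕ.+ j))) (ℕ.+-∸-assoc 1 i≤n) ⟩
      sumTo (suc (n ∸ i)) (λ j → F i (i ℕ.+ j))
        ≈⟨ sumTo-cong (suc (n ∸ i)) (λ {j} _ → trans (*-assoc _ _ _) (*-congˡ (*-cong
             (reflexive (≡.cong g (ℕ.m+n∸m≡n i j)))
             (reflexive (≡.cong h (≡.sym (ℕ.∸-+-assoc n i j))))))) ⟩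
      sumTo (suc (n ∸ i)) (λ j → f i * (g j * h (n ∸ i ∸ j)))  ∎

  *-inverse-unique : ∀ u v w → u * v ≈ 1# → u * w ≈ 1# → v ≈ w
  *-inverse-unique u v w uv≈1 uw≈1 = begin
    v                ≈⟨ *-identityʳ v ⟨
    v * 1#           ≈⟨ *-congˡ uw≈1 ⟨
    v * (u * w)      ≈⟨ *-assoc v u w ⟨
    (v * u) * w      ≈⟨ *-congʳ (trans (*-comm v u) uv≈1) ⟩
    1# * w           ≈⟨ *-identityˡ w ⟩
    w                ∎

  module _ (inv-correct : ∀ n → fromℕ (suc n) * inv n ≈ 1#) where

    factR≈fromℕ[n!] : ∀ n → factR n ≈ fromℕ (n !)
    factR≈fromℕ[n!] zero    = sym fromℕ-1
    factR≈fromℕ[n!] (suc n) = begin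
      factR n * fromℕ (suc n)       ≈⟨ *-congʳ (factR≈fromℕ[n!] n) ⟩
      fromℕ (n !) * fromℕ (suc n)   ≈⟨ *-comm _ _ ⟩
      fromℕ (suc n) * fromℕ (n !)   ≈⟨ fromℕ-* (suc n) (n !) ⟨
      fromℕ (suc n !)               ∎

    factR*invFact≈1# : ∀ n → factR n * invFact n ≈ 1#
    factR*invFact≈1# zero    = *-identityʳ 1#
    factR*invFact≈1# (suc n) = begin
      (factR n * fromℕ (suc n)) * (invFact n * inv n)   ≈⟨ *-interchange _ _ _ _ ⟩
      (factR n * invFact n) * (fromℕ (suc n) * inv n)   ≈⟨ *-cong (factR*invFact≈1# n) (inv-correct n) ⟩
      1# * 1#                                           ≈⟨ *-identityʳ 1# ⟩
      1#                                                ∎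

    factR-split : ∀ {n k} → k ≤ n → factR n ≈ binomR n k * (factR k * factR (n ∸ k))
    factR-split {n} {k} k≤n = begin
      factR n                                              ≈⟨ factR≈fromℕ[n!] n ⟩
      fromℕ (n !)                                          ≡⟨ ≡.cong fromℕ (nCk*[k!*[n∸k]!]≡n! k≤n) ⟨
      fromℕ ((n C k) ℕ.* (k ! ℕ.* (n ∸ k) !))              ≈⟨ fromℕ-* (n C k) _ ⟩
      binomR n k * fromℕ (k ! ℕ.* (n ∸ k) !)               ≈⟨ *-congˡ (fromℕ-* (k !) ((n ∸ k) !)) ⟩
      binomR n k * (fromℕ (k !) * fromℕ ((n ∸ k) !))       ≈⟨ *-congˡ (*-cong (factR≈fromℕ[n!] k) (factR≈fromℕ[n!] (n ∸ k))) ⟨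
      binomR n k * (factR k * factR (n ∸ k))               ∎

    binomR*invFact : ∀ {n k} → k ≤ n → binomR n k * invFact n ≈ invFact k * invFact (n ∸ k)
    binomR*invFact {n} {k} k≤n =
      *-inverse-unique (factR k * factR (n ∸ k)) _ _ split*binomR*invFact≈1#
        (trans (*-interchange _ _ _ _) (trans (*-cong (factR*invFact≈1# k) (factR*invFact≈1# (n ∸ k))) (*-identityʳ 1#)))
      where
      split*binomR*invFact≈1# : (factR k * factR (n ∸ k)) * (binomR n k * invFact n) ≈ 1#
      split*binomR*invFact≈1# = begin
        (factR k * factR (n ∸ k)) * (binomR n k * invFact n)   ≈⟨ *-assoc _ _ _ ⟨
        ((factR k * factR (n ∸ k)) * binomR n k) * invFact n   ≈⟨ *-congʳ (trans (factR-split k≤n) (*-comm _ _)) ⟨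
        factR n * invFact n                                    ≈⟨ factR*invFact≈1# n ⟩
        1#                                                     ∎

    factR*invFact[n∸k] : ∀ {n k} → k ≤ n → factR n * invFact (n ∸ k) ≈ binomR n k * factR k
    factR*invFact[n∸k] {n} {k} k≤n = begin
      factR n * invFact (n ∸ k)                                      ≈⟨ *-congʳ (factR-split k≤n) ⟩
      (binomR n k * (factR k * factR (n ∸ k))) * invFact (n ∸ k)     ≈⟨ *-assoc _ _ _ ⟩
      binomR n k * ((factR k * factR (n ∸ k)) * invFact (n ∸ k))     ≈⟨ *-congˡ (*-assoc _ _ _) ⟩
      binomR n k * (factR k * (factR (n ∸ k) * invFact (n ∸ k)))     ≈⟨ *-congˡ (*-congˡ (factR*invFact≈1# (n ∸ k))) ⟩
      binomR n k * (factR k * 1#)                                    ≈⟨ *-congˡ (*-identityʳ _) ⟩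
      binomR n k * factR k                                           ∎

    expS-+ : ∀ a b → expS (a + b) ≈ₛ expS a ⊛ expS b
    expS-+ a b m = begin
      (a + b) ^ m * invFact m
        ≈⟨ *-congʳ (binomial-theorem a b m) ⟩
      sumTo (suc m) (λ k → binomR m k * (a ^ k * b ^ (m ∸ k))) * invFact m
        ≈⟨ *-distribʳ-sumTo (invFact m) (suc m) _ ⟩
      sumTo (suc m) (λ k → binomR m k * (a ^ k * b ^ (m ∸ k)) * invFact m)
        ≈⟨ sumTo-cong (suc m) splitTerm ⟩
      sumTo (suc m) (λ k → (a ^ k * invFact k) * (b ^ (m ∸ k) * invFact (m ∸ k)))  ∎
      where
      splitTerm : ∀ {k} → k < suc m →
                  binomR m k * (a ^ k * b ^ (m ∸ k)) * invFact m
                  ≈ (a ^ k * invFact k) * (b ^ (m ∸ k) * invFact (m ∸ k))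
      splitTerm {k} (s≤s k≤m) = begin
        binomR m k * (a ^ k * b ^ (m ∸ k)) * invFact m      ≈⟨ *-congʳ (*-comm _ _) ⟩
        (a ^ k * b ^ (m ∸ k)) * binomR m k * invFact m      ≈⟨ *-assoc _ _ _ ⟩
        (a ^ k * b ^ (m ∸ k)) * (binomR m k * invFact m)    ≈⟨ *-congˡ (binomR*invFact k≤m) ⟩
        (a ^ k * b ^ (m ∸ k)) * (invFact k * invFact (m ∸ k))  ≈⟨ *-interchange _ _ _ _ ⟩
        (a ^ k * invFact k) * (b ^ (m ∸ k) * invFact (m ∸ k))  ∎

    genFun-+ : ∀ α x z y → genFun α (x + z) y ≈ₛ genFun α x y ⊛ expS z
    genFun-+ α x z y n = begin
      (E ⊛ (expS (x + z) ⊛ B)) n     ≈⟨ ⊛-congˡ E (⊛-congʳ B (expS-+ x z)) n ⟩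
      (E ⊛ ((expS x ⊛ eᶻ) ⊛ B)) n    ≈⟨ ⊛-congˡ E (⊛-assoc (expS x) eᶻ B) n ⟩
      (E ⊛ (expS x ⊛ (eᶻ ⊛ B))) n    ≈⟨ ⊛-congˡ E (⊛-congˡ (expS x) (⊛-comm eᶻ B)) n ⟩
      (E ⊛ (expS x ⊛ (B ⊛ eᶻ))) n    ≈⟨ ⊛-congˡ E (sym ∘ ⊛-assoc (expS x) B eᶻ) n ⟩
      (E ⊛ ((expS x ⊛ B) ⊛ eᶻ)) n    ≈⟨ ⊛-assoc E (expS x ⊛ B) eᶻ n ⟨
      ((E ⊛ (expS x ⊛ B)) ⊛ eᶻ) n    ∎
      where
      E  = eulerFactor α
      B  = bellFactor y
      eᶻ = expS z

    factR*[⊛expS] : ∀ G z n → factR n * (G ⊛ expS z) n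
                    ≈ sumTo (suc n) (λ k → binomR n k * (factR k * G k) * z ^ (n ∸ k))
    factR*[⊛expS] G z n =
      trans (*-distribˡ-sumTo (factR n) (suc n) _) (sumTo-cong (suc n) rearrange)
      where
      rearrange : ∀ {k} → k < suc n →
                  factR n * (G k * (z ^ (n ∸ k) * invFact (n ∸ k)))
                  ≈ binomR n k * (factR k * G k) * z ^ (n ∸ k)
      rearrange {k} (s≤s k≤n) = begin
        factR n * (G k * (z ^ (n ∸ k) * invFact (n ∸ k)))   ≈⟨ *-congˡ (*-congˡ (*-comm _ _)) ⟩
        factR n * (G k * (invFact (n ∸ k) * z ^ (n ∸ k)))   ≈⟨ *-congˡ (*-leftComm _ _ _) ⟩
        factR n * (invFact (n ∸ k) * (G k * z ^ (n ∸ k)))   ≈⟨ *-assoc _ _ _ ⟨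
        (factR n * invFact (n ∸ k)) * (G k * z ^ (n ∸ k))   ≈⟨ *-congʳ (factR*invFact[n∸k] k≤n) ⟩
        (binomR n k * factR k) * (G k * z ^ (n ∸ k))        ≈⟨ *-assoc _ _ _ ⟨
        binomR n k * factR k * G k * z ^ (n ∸ k)            ≈⟨ *-congʳ (*-assoc _ _ _) ⟩
        binomR n k * (factR k * G k) * z ^ (n ∸ k)          ∎

    BE-+ : ∀ n α x z y → BE n α (x + z) y ≈ sumTo (suc n) (λ k → binomR n k * BE k α x y * z ^ (n ∸ k))
    BE-+ n α x z y = trans (*-congˡ (genFun-+ α x z y n)) (factR*[⊛expS] (genFun α x y) z n)

mainTheorem5 : ∀ {c ℓ} (R : CommutativeRing c ℓ) (inv : ℕ → CommutativeRing.Carrier R)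
               → (∀ n → CommutativeRing._≈_ R (CommutativeRing._*_ R (BellEuler.fromℕ R inv (suc n)) (inv n)) (CommutativeRing.1# R))
               → ∀ (α x y : CommutativeRing.Carrier R) (n : ℕ)
               → CommutativeRing._≈_ R
                   (CommutativeRing._-_ R (BellEuler.BE R inv (suc n) α (CommutativeRing._+_ R x (CommutativeRing.1# R)) y) (BellEuler.BE R inv (suc n) α x y))
                   (BellEuler.sumTo R inv (suc n) (λ k → CommutativeRing._*_ R (BellEuler.binomR R inv (suc n) k) (BellEuler.BE R inv k α x y)))
mainTheorem5 R inv inv-correct α x y n = begin
  BE M α (x + 1#) y - BE M α x y
    ≈⟨ +-congʳ (BE-+ inv-correct M α x 1# y) ⟩
  sumTo (suc M) (λ k → binomR M k * BE k α x y * 1# ^ (M ∸ k)) - BE M α x y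
    ≈⟨ +-congʳ (sumTo-cong (suc M) (λ {k} _ → trans (*-congˡ (1#^n≈1# (M ∸ k))) (*-identityʳ _))) ⟩
  sumTo M (λ k → binomR M k * BE k α x y) + binomR M M * BE M α x y - BE M α x y
    ≈⟨ +-congʳ (+-congˡ (trans (*-congʳ binomR-n-n≈1#) (*-identityˡ _))) ⟩
  sumTo M (λ k → binomR M k * BE k α x y) + BE M α x y - BE M α x y
    ≈⟨ //-rightDividesʳ (BE M α x y) _ ⟩
  sumTo M (λ k → binomR M k * BE k α x y)  ∎
  where
  open CommutativeRing R
  open BellEuler R inv
  open BellEulerProperties R inv
  open GroupProperties +-group using (//-rightDividesʳ)
  open import Relation.Binary.Reasoning.Setoid setoid

  M : ℕ
  M = suc n

  binomR-n-n≈1# : binomR M M ≈ 1#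
  binomR-n-n≈1# = trans (reflexive (≡.cong fromℕ (nCn≡1 M))) fromℕ-1
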